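{- For all integers $A_1,A_2,B$, in $\tilde{\mathrm{CH}}_2$: $$\tilde h_B\tilde h_{A_1}\tilde h_{A_2}-\tilde h_B\tilde h_{A_1-1}\tilde h_{A_2-1}=\tilde h_B\tilde h_{A_1+A_2},$$ $$\tilde h_{A_1}\tilde h_B\tilde h_{A_2-1}+\tilde h_{A_1-1}\tilde h_B\tilde h_{A_2}-\tilde h_{A_1-1}\tilde h_1\tilde h_B\tilde h_{A_2-1}=\tilde h_B\tilde h_{A_1+A_2-1}.$$
   Context: Let $\mathrm{CH}_2$ be the commutative ring which is a free $\mathbb{Z}$-module with basis $\{h_i : i\ge 0\}$ and multiplication $h_ih_j=\sum_{k=0}^{\min(i,j)}h_{i+j-2k}$. Let $\tilde{\mathrm{CH}}_2$ be the free $\mathbb{Z}$-module with basis $\{\tilde h_i : i\in\mathbb{Z}\}$, with left $\mathrm{CH}_2$-action $h_i\tilde h_j=\sum_{k=0}^{i}\tilde h_{j-i+2k}$ ($i\ge0$), extended bilinearly. Let $L:\tilde{\mathrm{CH}}_2\to \mathrm{CH}_2$ be the $\mathbb{Z}$-linear map with $L(\tilde h_{ -1})=0$, $L(\tilde h_i)=h_i$ for $i\ge 0$, $L(\tilde h_i)=-h_{ -i-2}$ for $i\le -2$. The (associative, non-commutative) product on $\tilde{\mathrm{CH}}_2$ is $g_1g_2:=L(g_1)\,g_2$. Explicitly, $\tilde h_i\tilde h_j=\sum_{k=0}^{i}\tilde h_{j-i+2k}$ for $i\ge0$, $\tilde h_{ -1}\tilde h_j=0$, and $\tilde h_i\tilde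 h_j=-\sum_{k=0}^{ -i-2}\tilde h_{j+i+2+2k}$ for $i\le-2$. -}

module Defs where

open import Data.Nat as ℕ using (ℕ)
open import Data.Integer as ℤ using (ℤ; +_; -[1+_]; _+_; _*_; -_; _-_)
open import Data.Integer.Properties using () renaming (_≟_ to _≟ℤ_)
open import Data.Nat.Properties using () renaming (_≟_ to _≟ℕ_)
open import Data.List using (List; []; _∷_; _++_; map; concatMap; upTo)
open import Data.Product using (_×_; _,_)
open import Relation.Nullary using (yes; no)
open import Relation.Binary.PropositionalEquality using (_≡_)

-- Elements of CH₂ : finite formal ℤ-linear combinations of h_n (n : ℕ),
-- represented as lists of (coefficient , index).
CH₂ : Set
CH₂ = List (ℤ × ℕ)

-- Elements of ~CH₂ : finite formal ℤ-linear combinations of ~h_j (j : ℤ),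
-- represented as lists of (coefficient , index).
CH₂~ : Set
CH₂~ = List (ℤ × ℤ)

coeff : CH₂~ → ℤ → ℤ
coeff [] n = + 0
coeff ((c , j) ∷ xs) n with j ≟ℤ n
... | yes _ = c + coeff xs n
... | no  _ = coeff xs n

infix 4 _≈_
_≈_ : CH₂~ → CH₂~ → Set
x ≈ y = ∀ n → coeff x n ≡ coeff y n

h~ : ℤ → CH₂~
h~ j = (+ 1 , j) ∷ []

infixl 6 _⊕_ _⊖_
_⊕_ : CH₂~ → CH₂~ → CH₂~
x ⊕ y = x ++ y

⊝_ : CH₂~ → CH₂~
⊝ x = map (λ { (c , j) → (- c , j) }) x

_⊖_ : CH₂~ → CH₂~ → CH₂~
x ⊖ y = x ⊕ (⊝ y)

scale : ℤ → CH₂~ → CH₂~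
scale d x = map (λ { (c , j) → (d * c , j) }) x

actBasis : ℕ → ℤ → CH₂~
actBasis i j = map (λ k → (+ 1 , (j - + i) + + (2 ℕ.* k))) (upTo (ℕ.suc i))

act : CH₂ → CH₂~ → CH₂~
act a g = concatMap (λ { (c , i) → concatMap (λ { (d , j) → scale (c * d) (actBasis i j) }) g }) a

LBasis : ℤ → CH₂
LBasis (+ n) = (+ 1 , n) ∷ []
LBasis -[1+ ℕ.zero ] = []
LBasis -[1+ ℕ.suc m ] = (- (+ 1) , m) ∷ []   -- i = -(m+2) ↦ - h_m = - h_{-i-2}

L : CH₂~ → CH₂
L g = concatMap (λ { (c , i) → map (λ { (d , n) → (c * d , n) }) (LBasis i) }) g

infixl 7 _·_
_·_ : CH₂~ → CH₂~ → CH₂~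
g₁ · g₂ = act (L g₁) g₂

-- Pair a formal sum x with a function Φ : ℤ → ℤ by ⟪ x ∣ Φ ⟫ = Σ c·Φ(j); two sums are equal
-- iff all their pairings agree (pair with indicator functions).  Under this pairing,
-- multiplication transposes to explicit operators: ⟪ g · h̃_c ∣ Φ ⟫ = ⟪ g ∣ rᵀ c Φ ⟫ with
-- rᵀ c Φ a = h̃ᵀ a Φ c = ⟪ h̃_a h̃_c ∣ Φ ⟫, a signed sum of Φ over c - a, c - a + 2, …, c + a.
-- The first relation then follows from h̃ᵀ (1 + a) Φ x = Φ (x + 1 + a) + h̃ᵀ a Φ (x - 1),
-- together with linearity and translation invariance of h̃ᵀ a.  The second needs in addition
-- h̃ᵀ a V b = h̃ᵀ b V a for every V odd under y ↦ -2 - y: such V factor through L, so this is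
-- the commutativity of CH₂.
module Submission where

open import Defs
open import Data.Integer using (ℤ; _+_; _-_; +_)
open import Data.Product using (_×_)

open import Algebra.Bundles using (AbelianGroup)
open import Data.Integer using (-[1+_]; -_; _*_)
open import Data.Integer.Properties
  using ( _≟_; +-comm; +-assoc; +-identityˡ; +-identityʳ; +-inverseʳ; *-identityˡ; *-identityʳ
        ; *-zeroʳ; *-assoc; *-distribˡ-+; neg-involutive; neg-distrib-+; neg-distribˡ-*
        ; neg-distribʳ-*; pos-*; i-j≡0⇒i≡j; +-0-abelianGroup)
open import Algebra.Properties.Group (AbelianGroup.group +-0-abelianGroup)
  using (∙-cancelˡ; \\-leftDividesˡ; //-rightDividesˡ; //-rightDividesʳ)
open import Data.Integer.Tactic.RingSolver using (solve-∀; solve)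
import Data.Nat as ℕ
open import Data.Nat using (ℕ; zero; suc)
open import Data.List using (List; []; _∷_; _++_; map; concatMap; upTo)
open import Data.List.Properties using (upTo-∷ʳ)
open import Data.Product using (_,_)
open import Data.Bool using (if_then_else_)
open import Relation.Nullary.Decidable using (⌊_⌋; yes; no)
open import Relation.Binary.PropositionalEquality
open ≡-Reasoning

sumBy : {A : Set} → (A → ℤ) → List A → ℤ
sumBy f []       = + 0
sumBy f (x ∷ xs) = f x + sumBy f xs

sumBy-cong : {A : Set} {f g : A → ℤ} → f ≗ g → sumBy f ≗ sumBy g
sumBy-cong f≗g []       = refl
sumBy-cong f≗g (x ∷ xs) = cong₂ _+_ (f≗g x) (sumBy-cong f≗g xs)

sumBy-++ : {A : Set} (f : A → ℤ) (xs ys : List A) →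
           sumBy f (xs ++ ys) ≡ sumBy f xs + sumBy f ys
sumBy-++ f []       ys = sym (+-identityˡ (sumBy f ys))
sumBy-++ f (x ∷ xs) ys = begin
  f x + sumBy f (xs ++ ys)          ≡⟨ cong (_+_ (f x)) (sumBy-++ f xs ys) ⟩
  f x + (sumBy f xs + sumBy f ys)   ≡⟨ +-assoc (f x) (sumBy f xs) (sumBy f ys) ⟨
  f x + sumBy f xs + sumBy f ys     ∎

sumBy-map : {A B : Set} (f : B → ℤ) (g : A → B) (xs : List A) →
            sumBy f (map g xs) ≡ sumBy (λ x → f (g x)) xs
sumBy-map f g []       = refl
sumBy-map f g (x ∷ xs) = cong (_+_ (f (g x))) (sumBy-map f g xs)

sumBy-concatMap : {A B : Set} (f : B → ℤ) (g : A → List B) (xs : List A) →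
                  sumBy f (concatMap g xs) ≡ sumBy (λ x → sumBy f (g x)) xs
sumBy-concatMap f g []       = refl
sumBy-concatMap f g (x ∷ xs) =
  trans (sumBy-++ f (g x) (concatMap g xs)) (cong (_+_ (sumBy f (g x))) (sumBy-concatMap f g xs))

sumBy-*ˡ : {A : Set} (c : ℤ) (f : A → ℤ) (xs : List A) →
           sumBy (λ x → c * f x) xs ≡ c * sumBy f xs
sumBy-*ˡ c f []       = sym (*-zeroʳ c)
sumBy-*ˡ c f (x ∷ xs) =
  trans (cong (_+_ (c * f x)) (sumBy-*ˡ c f xs)) (sym (*-distribˡ-+ c (f x) (sumBy f xs)))

sumBy-neg : {A : Set} (f : A → ℤ) (xs : List A) → sumBy (λ x → - f x) xs ≡ - sumBy f xs
sumBy-neg f []       = refl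
sumBy-neg f (x ∷ xs) =
  trans (cong (_+_ (- f x)) (sumBy-neg f xs)) (sym (neg-distrib-+ (f x) (sumBy f xs)))

sumBy-upTo-suc : (g : ℕ → ℤ) (n : ℕ) → sumBy g (upTo (suc n)) ≡ sumBy g (upTo n) + g n
sumBy-upTo-suc g n = begin
  sumBy g (upTo (suc n))          ≡⟨ cong (sumBy g) (upTo-∷ʳ n) ⟨
  sumBy g (upTo n ++ n ∷ [])      ≡⟨ sumBy-++ g (upTo n) (n ∷ []) ⟩
  sumBy g (upTo n) + (g n + + 0)  ≡⟨ cong (_+_ (sumBy g (upTo n))) (+-identityʳ (g n)) ⟩
  sumBy g (upTo n) + g n          ∎

weight : {I : Set} → (I → ℤ) → ℤ × I → ℤ
weight Φ (c , i) = c * Φ i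

⟪_∣_⟫ : {I : Set} → List (ℤ × I) → (I → ℤ) → ℤ
⟪ x ∣ Φ ⟫ = sumBy (weight Φ) x

⟪⟫-cong : {I : Set} (x : List (ℤ × I)) {Φ Ψ : I → ℤ} → Φ ≗ Ψ → ⟪ x ∣ Φ ⟫ ≡ ⟪ x ∣ Ψ ⟫
⟪⟫-cong x Φ≗Ψ = sumBy-cong (λ (c , i) → cong (c *_) (Φ≗Ψ i)) x

⟪⟫-neg : {I : Set} (x : List (ℤ × I)) (Φ : I → ℤ) → ⟪ x ∣ (λ i → - Φ i) ⟫ ≡ - ⟪ x ∣ Φ ⟫
⟪⟫-neg x Φ = trans (sumBy-cong (λ (c , i) → sym (neg-distribʳ-* c (Φ i))) x) (sumBy-neg _ x)

⟪⟫-zero : {I : Set} (x : List (ℤ × I)) → ⟪ x ∣ (λ _ → + 0) ⟫ ≡ + 0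
⟪⟫-zero []            = refl
⟪⟫-zero ((c , _) ∷ x) = cong₂ _+_ (*-zeroʳ c) (⟪⟫-zero x)

⟪⊕⟫ : (x y : CH₂~) (Φ : ℤ → ℤ) → ⟪ x ⊕ y ∣ Φ ⟫ ≡ ⟪ x ∣ Φ ⟫ + ⟪ y ∣ Φ ⟫
⟪⊕⟫ x y Φ = sumBy-++ _ x y

⟪⊝⟫ : (x : CH₂~) (Φ : ℤ → ℤ) → ⟪ ⊝ x ∣ Φ ⟫ ≡ - ⟪ x ∣ Φ ⟫
⟪⊝⟫ x Φ = begin
  ⟪ ⊝ x ∣ Φ ⟫                           ≡⟨ sumBy-map _ _ x ⟩
  sumBy (λ (c , j) → (- c) * Φ j) x     ≡⟨ sumBy-cong (λ (c , j) → neg-distribˡ-* c (Φ j)) x ⟨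
  sumBy (λ (c , j) → - (c * Φ j)) x     ≡⟨ sumBy-neg _ x ⟩
  - ⟪ x ∣ Φ ⟫                           ∎

⟪⊖⟫ : (x y : CH₂~) (Φ : ℤ → ℤ) → ⟪ x ⊖ y ∣ Φ ⟫ ≡ ⟪ x ∣ Φ ⟫ - ⟪ y ∣ Φ ⟫
⟪⊖⟫ x y Φ = trans (⟪⊕⟫ x (⊝ y) Φ) (cong (_+_ (⟪ x ∣ Φ ⟫)) (⟪⊝⟫ y Φ))

⟪scale⟫ : (d : ℤ) (x : CH₂~) (Φ : ℤ → ℤ) → ⟪ scale d x ∣ Φ ⟫ ≡ d * ⟪ x ∣ Φ ⟫
⟪scale⟫ d x Φ = begin
  ⟪ scale d x ∣ Φ ⟫                       ≡⟨ sumBy-map _ _ x ⟩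
  sumBy (λ (c , j) → d * c * Φ j) x       ≡⟨ sumBy-cong (λ (c , j) → *-assoc d c (Φ j)) x ⟩
  sumBy (λ (c , j) → d * (c * Φ j)) x     ≡⟨ sumBy-*ˡ d _ x ⟩
  d * ⟪ x ∣ Φ ⟫                           ∎

⟪h~⟫ : (j : ℤ) (Φ : ℤ → ℤ) → ⟪ h~ j ∣ Φ ⟫ ≡ Φ j
⟪h~⟫ j Φ = trans (+-identityʳ (+ 1 * Φ j)) (*-identityˡ (Φ j))

indicator : ℤ → ℤ → ℤ
indicator n j = if ⌊ j ≟ n ⌋ then + 1 else + 0

coeff≡⟪∣indicator⟫ : (x : CH₂~) (n : ℤ) → coeff x n ≡ ⟪ x ∣ indicator n ⟫
coeff≡⟪∣indicator⟫ []            n = refl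
coeff≡⟪∣indicator⟫ ((c , j) ∷ x) n with j ≟ n
... | yes _ = cong₂ _+_ (sym (*-identityʳ c)) (coeff≡⟪∣indicator⟫ x n)
... | no  _ = begin
  coeff x n                               ≡⟨ coeff≡⟪∣indicator⟫ x n ⟩
  ⟪ x ∣ indicator n ⟫                     ≡⟨ +-identityˡ _ ⟨
  + 0 + ⟪ x ∣ indicator n ⟫               ≡⟨ cong (_+ ⟪ x ∣ indicator n ⟫) (*-zeroʳ c) ⟨
  c * + 0 + ⟪ x ∣ indicator n ⟫           ∎

-- A record rather than a bare ∀ Φ, so that x and y can be inferred from a proof.
infix 4 _≐_
record _≐_ (x y : CH₂~) : Set where
  constructor same-pairings
  field pairings : ∀ Φ → ⟪ x ∣ Φ ⟫ ≡ ⟪ y ∣ Φ ⟫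

≐⇒≈ : {x y : CH₂~} → x ≐ y → x ≈ y
≐⇒≈ {x} {y} (same-pairings x∼y) n =
  trans (coeff≡⟪∣indicator⟫ x n) (trans (x∼y (indicator n)) (sym (coeff≡⟪∣indicator⟫ y n)))

-- hᵀ i Φ x = Σ_{k ≤ i} Φ (x - i + 2k), the transpose of the action of h_i.
hᵀ : ℕ → (ℤ → ℤ) → ℤ → ℤ
hᵀ zero    Φ x = Φ x
hᵀ (suc i) Φ x = Φ (x + + suc i) + hᵀ i Φ (x - + 1)

sumBy-evenSteps : (Φ : ℤ → ℤ) (t : ℤ) (i : ℕ) →
                  sumBy (λ k → Φ (t + + (2 ℕ.* k))) (upTo (suc i)) ≡ hᵀ i Φ (t + + i)
sumBy-evenSteps Φ t zero    = +-identityʳ (Φ (t + + 0))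
sumBy-evenSteps Φ t (suc i) = begin
  sumBy g (upTo (suc (suc i)))
    ≡⟨ sumBy-upTo-suc g (suc i) ⟩
  sumBy g (upTo (suc i)) + Φ (t + + (2 ℕ.* suc i))
    ≡⟨ cong₂ _+_ (sumBy-evenSteps Φ t i) (cong Φ (twice (suc i))) ⟩
  hᵀ i Φ (t + + i) + Φ (t + + suc i + + suc i)
    ≡⟨ +-comm (hᵀ i Φ (t + + i)) _ ⟩
  Φ (t + + suc i + + suc i) + hᵀ i Φ (t + + i)
    ≡⟨ cong (λ y → Φ (t + + suc i + + suc i) + hᵀ i Φ y) (solve (t ∷ [])) ⟩
  hᵀ (suc i) Φ (t + + suc i) ∎
  where
  g : ℕ → ℤ
  g k = Φ (t + + (2 ℕ.* k))
  twice : ∀ n → t + + (2 ℕ.* n) ≡ t + + n + + n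
  twice n = trans (cong (_+_ t) (pos-* 2 n)) (double t (+ n))
    where
    double : ∀ t s → t + + 2 * s ≡ t + s + s
    double = solve-∀

⟪actBasis⟫ : (i : ℕ) (j : ℤ) (Φ : ℤ → ℤ) → ⟪ actBasis i j ∣ Φ ⟫ ≡ hᵀ i Φ j
⟪actBasis⟫ i j Φ = begin
  ⟪ actBasis i j ∣ Φ ⟫
    ≡⟨ sumBy-map (weight Φ) (λ k → (+ 1 , j - + i + + (2 ℕ.* k))) (upTo (suc i)) ⟩
  sumBy (λ k → + 1 * Φ (j - + i + + (2 ℕ.* k))) (upTo (suc i))
    ≡⟨ sumBy-cong (λ k → *-identityˡ (Φ (j - + i + + (2 ℕ.* k)))) (upTo (suc i)) ⟩
  sumBy (λ k → Φ (j - + i + + (2 ℕ.* k))) (upTo (suc i))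
    ≡⟨ sumBy-evenSteps Φ (j - + i) i ⟩
  hᵀ i Φ (j - + i + + i)
    ≡⟨ cong (hᵀ i Φ) (//-rightDividesˡ (+ i) j) ⟩
  hᵀ i Φ j ∎

⟪act⟫ : (a : CH₂) (g : CH₂~) (Φ : ℤ → ℤ) → ⟪ act a g ∣ Φ ⟫ ≡ ⟪ a ∣ (λ i → ⟪ g ∣ hᵀ i Φ ⟫) ⟫
⟪act⟫ a g Φ = trans (sumBy-concatMap _ _ a) (sumBy-cong termwise a)
  where
  termwise : ∀ ((c , i) : ℤ × ℕ) →
             ⟪ concatMap (λ (d , j) → scale (c * d) (actBasis i j)) g ∣ Φ ⟫ ≡ c * ⟪ g ∣ hᵀ i Φ ⟫
  termwise (c , i) = begin
    _                                         ≡⟨ sumBy-concatMap _ _ g ⟩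
    sumBy (λ (d , j) → ⟪ scale (c * d) (actBasis i j) ∣ Φ ⟫) g
      ≡⟨ sumBy-cong (λ (d , j) → trans (⟪scale⟫ (c * d) (actBasis i j) Φ)
                                        (cong (c * d *_) (⟪actBasis⟫ i j Φ))) g ⟩
    sumBy (λ (d , j) → c * d * hᵀ i Φ j) g    ≡⟨ sumBy-cong (λ (d , j) → *-assoc c d (hᵀ i Φ j)) g ⟩
    sumBy (λ (d , j) → c * (d * hᵀ i Φ j)) g  ≡⟨ sumBy-*ˡ c _ g ⟩
    c * ⟪ g ∣ hᵀ i Φ ⟫                        ∎

Lᵀ : (ℕ → ℤ) → ℤ → ℤ
Lᵀ Ψ (+ n)          = Ψ n
Lᵀ Ψ -[1+ zero ]    = + 0
Lᵀ Ψ -[1+ suc m ]   = - Ψ m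

⟪L⟫ : (g : CH₂~) (Ψ : ℕ → ℤ) → ⟪ L g ∣ Ψ ⟫ ≡ ⟪ g ∣ Lᵀ Ψ ⟫
⟪L⟫ g Ψ = trans (sumBy-concatMap _ _ g) (sumBy-cong termwise g)
  where
  unit : ∀ c u → c * + 1 * u + + 0 ≡ c * u
  unit = solve-∀
  minusUnit : ∀ c u → c * - + 1 * u + + 0 ≡ c * - u
  minusUnit = solve-∀
  termwise : ∀ ((c , i) : ℤ × ℤ) →
             ⟪ map (λ (d , n) → (c * d , n)) (LBasis i) ∣ Ψ ⟫ ≡ c * Lᵀ Ψ i
  termwise (c , + n)          = unit c (Ψ n)
  termwise (c , -[1+ zero ])  = sym (*-zeroʳ c)
  termwise (c , -[1+ suc m ]) = minusUnit c (Ψ m)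

⟪⟫-Lᵀ : (g : CH₂~) (F : ℕ → ℤ → ℤ) (a : ℤ) →
        ⟪ g ∣ (λ x → Lᵀ (λ i → F i x) a) ⟫ ≡ Lᵀ (λ i → ⟪ g ∣ F i ⟫) a
⟪⟫-Lᵀ g F (+ n)          = refl
⟪⟫-Lᵀ g F -[1+ zero ]    = ⟪⟫-zero g
⟪⟫-Lᵀ g F -[1+ suc m ]   = ⟪⟫-neg g (F m)

Lᵀ-cong : {Ψ Ψ′ : ℕ → ℤ} → Ψ ≗ Ψ′ → Lᵀ Ψ ≗ Lᵀ Ψ′
Lᵀ-cong Ψ≗Ψ′ (+ n)          = Ψ≗Ψ′ n
Lᵀ-cong Ψ≗Ψ′ -[1+ zero ]    = refl
Lᵀ-cong Ψ≗Ψ′ -[1+ suc m ]   = cong -_ (Ψ≗Ψ′ m)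

Lᵀ-neg : (Ψ : ℕ → ℤ) (a : ℤ) → Lᵀ (λ i → - Ψ i) a ≡ - Lᵀ Ψ a
Lᵀ-neg Ψ (+ n)          = refl
Lᵀ-neg Ψ -[1+ zero ]    = refl
Lᵀ-neg Ψ -[1+ suc m ]   = refl

Lᵀ-minus : (Ψ Ψ′ : ℕ → ℤ) (a : ℤ) → Lᵀ (λ i → Ψ i - Ψ′ i) a ≡ Lᵀ Ψ a - Lᵀ Ψ′ a
Lᵀ-minus Ψ Ψ′ (+ n)          = refl
Lᵀ-minus Ψ Ψ′ -[1+ zero ]    = refl
Lᵀ-minus Ψ Ψ′ -[1+ suc m ]   = neg-distrib-+ (Ψ m) (- Ψ′ m)

-- Oddness for the reflection y ↦ -2 - y, which fixes -1; L kills exactly the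
-- combinations ~h_j + ~h_{-2-j}, so odd functions are those that factor through L.
Odd : (ℤ → ℤ) → Set
Odd f = ∀ y → f (- + 2 - y) ≡ - f y

x≡-x⇒x≡0 : ∀ {x} → x ≡ - x → x ≡ + 0
x≡-x⇒x≡0 {+ zero}   _  = refl
x≡-x⇒x≡0 {+ suc n}  ()
x≡-x⇒x≡0 { -[1+ n ]} ()

Odd⇒vanishes-at-−1 : {f : ℤ → ℤ} → Odd f → f -[1+ 0 ] ≡ + 0
Odd⇒vanishes-at-−1 odd = x≡-x⇒x≡0 (odd -[1+ 0 ])

Lᵀ-odd : (Ψ : ℕ → ℤ) → Odd (Lᵀ Ψ)
Lᵀ-odd Ψ (+ zero)         = refl
Lᵀ-odd Ψ (+ suc n)        = refl
Lᵀ-odd Ψ -[1+ zero ]      = refl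
Lᵀ-odd Ψ -[1+ suc m ]     = sym (neg-involutive (Ψ m))

hᵀ-cong : {Φ Ψ : ℤ → ℤ} → Φ ≗ Ψ → ∀ i x → hᵀ i Φ x ≡ hᵀ i Ψ x
hᵀ-cong Φ≗Ψ zero    x = Φ≗Ψ x
hᵀ-cong Φ≗Ψ (suc i) x = cong₂ _+_ (Φ≗Ψ _) (hᵀ-cong Φ≗Ψ i _)

hᵀ-minus : (Φ Ψ : ℤ → ℤ) (i : ℕ) (x : ℤ) →
           hᵀ i (λ y → Φ y - Ψ y) x ≡ hᵀ i Φ x - hᵀ i Ψ x
hᵀ-minus Φ Ψ zero    x = refl
hᵀ-minus Φ Ψ (suc i) x =
  trans (cong (_+_ (Φ (x + + suc i) - Ψ (x + + suc i))) (hᵀ-minus Φ Ψ i (x - + 1)))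
        (interchange (Φ (x + + suc i)) (Ψ (x + + suc i)) _ _)
  where
  interchange : ∀ p q r s → p - q + (r - s) ≡ p + r - (q + s)
  interchange = solve-∀

hᵀ-shift : (Φ : ℤ → ℤ) (c : ℤ) (i : ℕ) (x : ℤ) →
           hᵀ i (λ y → Φ (y + c)) x ≡ hᵀ i Φ (x + c)
hᵀ-shift Φ c zero    x = refl
hᵀ-shift Φ c (suc i) x =
  cong₂ _+_ (cong Φ (solve (x ∷ c ∷ [])))
            (trans (hᵀ-shift Φ c i (x - + 1)) (cong (hᵀ i Φ) (solve (x ∷ c ∷ []))))

hᵀ-peelBottom : (i : ℕ) (Φ : ℤ → ℤ) (x : ℤ) →
                hᵀ (suc i) Φ x ≡ Φ (x - + suc i) + hᵀ i Φ (x + + 1)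
hᵀ-peelBottom zero    Φ x = +-comm (Φ (x + + 1)) (Φ (x - + 1))
hᵀ-peelBottom (suc i) Φ x = begin
  Φ (x + + suc (suc i)) + hᵀ (suc i) Φ (x - + 1)
    ≡⟨ cong (_+_ (Φ (x + + suc (suc i)))) (hᵀ-peelBottom i Φ (x - + 1)) ⟩
  Φ (x + + suc (suc i)) + (Φ (x - + 1 - + suc i) + hᵀ i Φ (x - + 1 + + 1))
    ≡⟨ swap (Φ (x + + suc (suc i))) (Φ (x - + 1 - + suc i)) _ ⟩
  Φ (x - + 1 - + suc i) + (Φ (x + + suc (suc i)) + hᵀ i Φ (x - + 1 + + 1))
    ≡⟨ cong₂ (λ u v → Φ u + (Φ v + hᵀ i Φ (x - + 1 + + 1)))
             (solve (x ∷ [])) (solve (x ∷ [])) ⟩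
  Φ (x - + suc (suc i)) + (Φ (x + + 1 + + suc i) + hᵀ i Φ (x - + 1 + + 1))
    ≡⟨ cong (λ y → Φ (x - + suc (suc i)) + (Φ (x + + 1 + + suc i) + hᵀ i Φ y))
            (solve (x ∷ [])) ⟩
  Φ (x - + suc (suc i)) + hᵀ (suc i) Φ (x + + 1) ∎
  where
  swap : ∀ p q r → p + (q + r) ≡ q + (p + r)
  swap = solve-∀

hᵀ-odd : {Φ : ℤ → ℤ} → Odd Φ → ∀ i → Odd (hᵀ i Φ)
hᵀ-odd odd zero    x = odd x
hᵀ-odd {Φ} odd (suc i) x = begin
  Φ (- + 2 - x + + suc i) + hᵀ i Φ (- + 2 - x - + 1)
    ≡⟨ cong₂ (λ u v → Φ u + hᵀ i Φ v) (solve (x ∷ [])) (solve (x ∷ [])) ⟩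
  Φ (- + 2 - (x - + suc i)) + hᵀ i Φ (- + 2 - (x + + 1))
    ≡⟨ cong₂ _+_ (odd (x - + suc i)) (hᵀ-odd odd i (x + + 1)) ⟩
  - Φ (x - + suc i) + - hᵀ i Φ (x + + 1)
    ≡⟨ neg-distrib-+ (Φ (x - + suc i)) (hᵀ i Φ (x + + 1)) ⟨
  - (Φ (x - + suc i) + hᵀ i Φ (x + + 1))
    ≡⟨ cong -_ (hᵀ-peelBottom i Φ x) ⟨
  - hᵀ (suc i) Φ x ∎

h̃ᵀ : ℤ → (ℤ → ℤ) → ℤ → ℤ
h̃ᵀ a Φ x = Lᵀ (λ i → hᵀ i Φ x) a

rᵀ : ℤ → (ℤ → ℤ) → ℤ → ℤ
rᵀ c Φ a = h̃ᵀ a Φ c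

⟪·⟫ : (g₁ g₂ : CH₂~) (Φ : ℤ → ℤ) → ⟪ g₁ · g₂ ∣ Φ ⟫ ≡ ⟪ g₁ ∣ (λ a → ⟪ g₂ ∣ h̃ᵀ a Φ ⟫) ⟫
⟪·⟫ g₁ g₂ Φ = begin
  ⟪ act (L g₁) g₂ ∣ Φ ⟫                          ≡⟨ ⟪act⟫ (L g₁) g₂ Φ ⟩
  ⟪ L g₁ ∣ (λ i → ⟪ g₂ ∣ hᵀ i Φ ⟫) ⟫            ≡⟨ ⟪L⟫ g₁ _ ⟩
  ⟪ g₁ ∣ Lᵀ (λ i → ⟪ g₂ ∣ hᵀ i Φ ⟫) ⟫           ≡⟨ ⟪⟫-cong g₁ (λ a → ⟪⟫-Lᵀ g₂ (λ i → hᵀ i Φ) a) ⟨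
  ⟪ g₁ ∣ (λ a → ⟪ g₂ ∣ h̃ᵀ a Φ ⟫) ⟫              ∎

⟪·h~⟫ : (g : CH₂~) (c : ℤ) (Φ : ℤ → ℤ) → ⟪ g · h~ c ∣ Φ ⟫ ≡ ⟪ g ∣ rᵀ c Φ ⟫
⟪·h~⟫ g c Φ = trans (⟪·⟫ g (h~ c) Φ) (⟪⟫-cong g (λ a → ⟪h~⟫ c (h̃ᵀ a Φ)))

⟪h~·h~⟫ : (a b : ℤ) (Φ : ℤ → ℤ) → ⟪ h~ a · h~ b ∣ Φ ⟫ ≡ h̃ᵀ a Φ b
⟪h~·h~⟫ a b Φ = trans (⟪·h~⟫ (h~ a) b Φ) (⟪h~⟫ a (rᵀ b Φ))

⟪h~·h~·h~⟫ : (a b c : ℤ) (Φ : ℤ → ℤ) → ⟪ h~ a · h~ b · h~ c ∣ Φ ⟫ ≡ h̃ᵀ a (rᵀ c Φ) b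
⟪h~·h~·h~⟫ a b c Φ = trans (⟪·h~⟫ (h~ a · h~ b) c Φ) (⟪h~·h~⟫ a b (rᵀ c Φ))

⟪h~·h~·h~·h~⟫ : (a b c d : ℤ) (Φ : ℤ → ℤ) →
                ⟪ h~ a · h~ b · h~ c · h~ d ∣ Φ ⟫ ≡ h̃ᵀ a (rᵀ c (rᵀ d Φ)) b
⟪h~·h~·h~·h~⟫ a b c d Φ = trans (⟪·h~⟫ (h~ a · h~ b · h~ c) d Φ) (⟪h~·h~·h~⟫ a b c (rᵀ d Φ))

h̃ᵀ-cong : (a : ℤ) {Φ Ψ : ℤ → ℤ} → Φ ≗ Ψ → h̃ᵀ a Φ ≗ h̃ᵀ a Ψ
h̃ᵀ-cong a Φ≗Ψ x = Lᵀ-cong (λ i → hᵀ-cong Φ≗Ψ i x) a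

h̃ᵀ-minus : (a : ℤ) (Φ Ψ : ℤ → ℤ) (x : ℤ) →
           h̃ᵀ a (λ y → Φ y - Ψ y) x ≡ h̃ᵀ a Φ x - h̃ᵀ a Ψ x
h̃ᵀ-minus a Φ Ψ x = trans (Lᵀ-cong (λ i → hᵀ-minus Φ Ψ i x) a) (Lᵀ-minus _ _ a)

h̃ᵀ-shift : (a : ℤ) (Φ : ℤ → ℤ) (c x : ℤ) → h̃ᵀ a (λ y → Φ (y + c)) x ≡ h̃ᵀ a Φ (x + c)
h̃ᵀ-shift a Φ c x = Lᵀ-cong (λ i → hᵀ-shift Φ c i x) a

h̃ᵀ-odd : {Φ : ℤ → ℤ} → Odd Φ → ∀ a → Odd (h̃ᵀ a Φ)
h̃ᵀ-odd odd a x = trans (Lᵀ-cong (λ i → hᵀ-odd odd i x) a) (Lᵀ-neg _ a)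

rᵀ-odd : (c : ℤ) (Φ : ℤ → ℤ) → Odd (rᵀ c Φ)
rᵀ-odd c Φ = Lᵀ-odd (λ i → hᵀ i Φ c)

h̃ᵀ-peelTop : (a : ℤ) (Φ : ℤ → ℤ) (x : ℤ) →
             h̃ᵀ (+ 1 + a) Φ x ≡ Φ (x + (+ 1 + a)) + h̃ᵀ a Φ (x - + 1)
h̃ᵀ-peelTop (+ i)                Φ x = refl
h̃ᵀ-peelTop -[1+ zero ]          Φ x =
  sym (trans (+-identityʳ (Φ (x + + 0))) (cong Φ (+-identityʳ x)))
h̃ᵀ-peelTop -[1+ suc zero ]      Φ x = sym (+-inverseʳ (Φ (x - + 1)))
h̃ᵀ-peelTop -[1+ suc (suc m) ]   Φ x = begin
  - hᵀ m Φ x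
    ≡⟨ cong (λ y → - hᵀ m Φ y) (solve (x ∷ [])) ⟩
  - hᵀ m Φ (x - + 1 + + 1)
    ≡⟨ \\-leftDividesˡ (Φ (x - + 1 - + suc m)) _ ⟨
  Φ (x - + 1 - + suc m) + (- Φ (x - + 1 - + suc m) + - hᵀ m Φ (x - + 1 + + 1))
    ≡⟨ cong₂ (λ u v → Φ u + v) (solve (x ∷ []))
             (sym (neg-distrib-+ (Φ (x - + 1 - + suc m)) _)) ⟩
  Φ (x + -[1+ suc m ]) + - (Φ (x - + 1 - + suc m) + hᵀ m Φ (x - + 1 + + 1))
    ≡⟨ cong (λ v → Φ (x + -[1+ suc m ]) + - v) (hᵀ-peelBottom m Φ (x - + 1)) ⟨
  Φ (x + -[1+ suc m ]) + - hᵀ (suc m) Φ (x - + 1) ∎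

h̃ᵀ-peelBottom : (a : ℤ) (Φ : ℤ → ℤ) (x : ℤ) →
                h̃ᵀ (+ 1 + a) Φ x ≡ Φ (x - (+ 1 + a)) + h̃ᵀ a Φ (x + + 1)
h̃ᵀ-peelBottom (+ i)                Φ x = hᵀ-peelBottom i Φ x
h̃ᵀ-peelBottom -[1+ zero ]          Φ x =
  sym (trans (+-identityʳ (Φ (x + + 0))) (cong Φ (+-identityʳ x)))
h̃ᵀ-peelBottom -[1+ suc zero ]      Φ x = sym (+-inverseʳ (Φ (x + + 1)))
h̃ᵀ-peelBottom -[1+ suc (suc m) ]   Φ x = begin
  - hᵀ m Φ x
    ≡⟨ cong (λ y → - hᵀ m Φ y) (solve (x ∷ [])) ⟩
  - hᵀ m Φ (x + + 1 - + 1)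
    ≡⟨ \\-leftDividesˡ (Φ (x + + 1 + + suc m)) _ ⟨
  Φ (x + + 1 + + suc m) + (- Φ (x + + 1 + + suc m) + - hᵀ m Φ (x + + 1 - + 1))
    ≡⟨ cong₂ (λ u v → Φ u + v) (solve (x ∷ []))
             (sym (neg-distrib-+ (Φ (x + + 1 + + suc m)) _)) ⟩
  Φ (x - -[1+ suc m ]) + - hᵀ (suc m) Φ (x + + 1) ∎

h̃ᵀ-step : (b : ℤ) (Φ : ℤ → ℤ) (y : ℤ) →
          Φ (y - (+ 1 + b)) + h̃ᵀ b Φ (y + + 1) ≡ Φ (y + (+ 1 + b)) + h̃ᵀ b Φ (y - + 1)
h̃ᵀ-step b Φ y = trans (sym (h̃ᵀ-peelBottom b Φ y)) (h̃ᵀ-peelTop b Φ y)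

module _ {V : ℤ → ℤ} (odd : Odd V) where

  Commutes : ℤ → Set
  Commutes a = ∀ b → h̃ᵀ a V b ≡ h̃ᵀ b V a

  commutes-−1 : Commutes -[1+ 0 ]
  commutes-−1 b = sym (Odd⇒vanishes-at-−1 (h̃ᵀ-odd odd b))

  -- h̃ᵀ-step at the fixed point y = -1 of the reflection reads  -V b + u ≡ V b - u.
  commutes-0 : Commutes (+ 0)
  commutes-0 b = sym (i-j≡0⇒i≡j u (V b) (x≡-x⇒x≡0 (begin
    u - V b
      ≡⟨ +-comm u (- V b) ⟩
    - V b + u
      ≡⟨ cong (_+ u) (odd b) ⟨
    V (- + 2 - b) + u
      ≡⟨ cong (λ y → V y + u) (solve (b ∷ [])) ⟩
    V (-[1+ 0 ] - (+ 1 + b)) + h̃ᵀ b V (-[1+ 0 ] + + 1)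
      ≡⟨ h̃ᵀ-step b V -[1+ 0 ] ⟩
    V (-[1+ 0 ] + (+ 1 + b)) + h̃ᵀ b V (- + 2 - + 0)
      ≡⟨ cong₂ _+_ (cong V (solve (b ∷ []))) (h̃ᵀ-odd odd b (+ 0)) ⟩
    V b + - u
      ≡⟨ flip (V b) u ⟩
    - (u - V b) ∎)))
    where
    u : ℤ
    u = h̃ᵀ b V (+ 0)
    flip : ∀ p q → p + - q ≡ - (q - p)
    flip = solve-∀

  commutes-step : ∀ a → Commutes a → Commutes (+ 1 + (+ 1 + a))
  commutes-step a comm b = ∙-cancelˡ (V (a - b)) _ _ (begin
    V (a - b) + h̃ᵀ (+ 1 + (+ 1 + a)) V b
      ≡⟨ cong (_+_ (V (a - b))) (h̃ᵀ-peelBottom (+ 1 + a) V b) ⟩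
    V (a - b) + (V (b - (+ 1 + (+ 1 + a))) + h̃ᵀ (+ 1 + a) V (b + + 1))
      ≡⟨ cong (λ w → V (a - b) + (V (b - (+ 1 + (+ 1 + a))) + w)) (h̃ᵀ-peelTop a V (b + + 1)) ⟩
    V (a - b) + (V (b - (+ 1 + (+ 1 + a))) + (V (b + + 1 + (+ 1 + a)) + h̃ᵀ a V (b + + 1 - + 1)))
      ≡⟨ cong₂ (λ u v → V (a - b) + (V u + (V v + h̃ᵀ a V (b + + 1 - + 1))))
               (solve (a ∷ b ∷ [])) (solve (a ∷ b ∷ [])) ⟩
    V (a - b) + (V (- + 2 - (a - b)) + (V (a + b + + 2) + h̃ᵀ a V (b + + 1 - + 1)))
      ≡⟨ cong (λ w → V (a - b) + (V (- + 2 - (a - b)) + (V (a + b + + 2) + h̃ᵀ a V w)))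
              (solve (b ∷ [])) ⟩
    V (a - b) + (V (- + 2 - (a - b)) + (V (a + b + + 2) + h̃ᵀ a V b))
      ≡⟨ cong₂ (λ u v → V (a - b) + (u + (V (a + b + + 2) + v))) (odd (a - b)) (comm b) ⟩
    V (a - b) + (- V (a - b) + (V (a + b + + 2) + h̃ᵀ b V a))
      ≡⟨ \\-leftDividesˡ (V (a - b)) _ ⟩
    V (a + b + + 2) + h̃ᵀ b V a
      ≡⟨ cong₂ (λ u v → V u + h̃ᵀ b V v) (solve (a ∷ b ∷ [])) (solve (a ∷ [])) ⟩
    V ((+ 1 + a) + (+ 1 + b)) + h̃ᵀ b V ((+ 1 + a) - + 1)
      ≡⟨ h̃ᵀ-step b V (+ 1 + a) ⟨
    V ((+ 1 + a) - (+ 1 + b)) + h̃ᵀ b V ((+ 1 + a) + + 1)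
      ≡⟨ cong₂ (λ u v → V u + h̃ᵀ b V v) (solve (a ∷ b ∷ [])) (solve (a ∷ [])) ⟩
    V (a - b) + h̃ᵀ b V (+ 1 + (+ 1 + a)) ∎)

  commutes-reflect : ∀ a → Commutes a → Commutes (- + 2 - a)
  commutes-reflect a comm b = begin
    h̃ᵀ (- + 2 - a) V b   ≡⟨ Lᵀ-odd (λ i → hᵀ i V b) a ⟩
    - h̃ᵀ a V b           ≡⟨ cong -_ (comm b) ⟩
    - h̃ᵀ b V a           ≡⟨ h̃ᵀ-odd odd b a ⟨
    h̃ᵀ b V (- + 2 - a)   ∎

  commutes-+ : ∀ n → Commutes (+ n)
  commutes-+ zero          = commutes-0
  commutes-+ (suc zero)    = commutes-step -[1+ 0 ] commutes-−1
  commutes-+ (suc (suc n)) = commutes-step (+ n) (commutes-+ n)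

  h̃ᵀ-comm : ∀ a b → h̃ᵀ a V b ≡ h̃ᵀ b V a
  h̃ᵀ-comm (+ n)                = commutes-+ n
  h̃ᵀ-comm -[1+ zero ]          = commutes-−1
  h̃ᵀ-comm -[1+ suc zero ]      = commutes-reflect (+ 0) commutes-0
  h̃ᵀ-comm -[1+ suc (suc m) ]   = commutes-reflect (+ suc m) (commutes-+ (suc m))

rᵀ-difference : (c : ℤ) (Φ : ℤ → ℤ) (a : ℤ) →
                rᵀ c Φ a - rᵀ (c - + 1) Φ (a - + 1) ≡ Φ (a + c)
rᵀ-difference c Φ a = begin
  h̃ᵀ a Φ c - h̃ᵀ (a - + 1) Φ (c - + 1)
    ≡⟨ cong (λ a′ → h̃ᵀ a′ Φ c - h̃ᵀ (a - + 1) Φ (c - + 1))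
            (sym (trans (+-comm (+ 1) (a - + 1)) (//-rightDividesˡ (+ 1) a))) ⟩
  h̃ᵀ (+ 1 + (a - + 1)) Φ c - h̃ᵀ (a - + 1) Φ (c - + 1)
    ≡⟨ cong (_- h̃ᵀ (a - + 1) Φ (c - + 1)) (h̃ᵀ-peelTop (a - + 1) Φ c) ⟩
  Φ (c + (+ 1 + (a - + 1))) + h̃ᵀ (a - + 1) Φ (c - + 1) - h̃ᵀ (a - + 1) Φ (c - + 1)
    ≡⟨ //-rightDividesʳ _ _ ⟩
  Φ (c + (+ 1 + (a - + 1)))
    ≡⟨ cong Φ (solve (a ∷ c ∷ [])) ⟩
  Φ (a + c) ∎

h̃ᵀ-rᵀ-difference : (B : ℤ) (Φ : ℤ → ℤ) (c a : ℤ) →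
                   h̃ᵀ B (rᵀ c Φ) a - h̃ᵀ B (rᵀ (c - + 1) Φ) (a - + 1) ≡ h̃ᵀ B Φ (a + c)
h̃ᵀ-rᵀ-difference B Φ c a = begin
  h̃ᵀ B (rᵀ c Φ) a - h̃ᵀ B (rᵀ (c - + 1) Φ) (a - + 1)
    ≡⟨ cong (_-_ (h̃ᵀ B (rᵀ c Φ) a)) (h̃ᵀ-shift B (rᵀ (c - + 1) Φ) (- + 1) a) ⟨
  h̃ᵀ B (rᵀ c Φ) a - h̃ᵀ B (λ y → rᵀ (c - + 1) Φ (y - + 1)) a
    ≡⟨ h̃ᵀ-minus B (rᵀ c Φ) (λ y → rᵀ (c - + 1) Φ (y - + 1)) a ⟨
  h̃ᵀ B (λ y → rᵀ c Φ y - rᵀ (c - + 1) Φ (y - + 1)) a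
    ≡⟨ h̃ᵀ-cong B (rᵀ-difference c Φ) a ⟩
  h̃ᵀ B (λ y → Φ (y + c)) a
    ≡⟨ h̃ᵀ-shift B Φ c a ⟩
  h̃ᵀ B Φ (a + c) ∎

first-relation : (A₁ A₂ B : ℤ) →
  h~ B · h~ A₁ · h~ A₂ ⊖ h~ B · h~ (A₁ - + 1) · h~ (A₂ - + 1) ≐ h~ B · h~ (A₁ + A₂)
first-relation A₁ A₂ B = same-pairings λ Φ → begin
  ⟪ h~ B · h~ A₁ · h~ A₂ ⊖ h~ B · h~ (A₁ - + 1) · h~ (A₂ - + 1) ∣ Φ ⟫
    ≡⟨ ⟪⊖⟫ (h~ B · h~ A₁ · h~ A₂) _ Φ ⟩
  ⟪ h~ B · h~ A₁ · h~ A₂ ∣ Φ ⟫ - ⟪ h~ B · h~ (A₁ - + 1) · h~ (A₂ - + 1) ∣ Φ ⟫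
    ≡⟨ cong₂ _-_ (⟪h~·h~·h~⟫ B A₁ A₂ Φ) (⟪h~·h~·h~⟫ B (A₁ - + 1) (A₂ - + 1) Φ) ⟩
  h̃ᵀ B (rᵀ A₂ Φ) A₁ - h̃ᵀ B (rᵀ (A₂ - + 1) Φ) (A₁ - + 1)
    ≡⟨ h̃ᵀ-rᵀ-difference B Φ A₂ A₁ ⟩
  h̃ᵀ B Φ (A₁ + A₂)
    ≡⟨ ⟪h~·h~⟫ B (A₁ + A₂) Φ ⟨
  ⟪ h~ B · h~ (A₁ + A₂) ∣ Φ ⟫ ∎

-- The last term contains ~h_1, and h_1 h_{A₁-1} = h_{A₁} + h_{A₁-2}: this cancels the first term
-- and leaves the shape of the first relation with A₁ replaced by A₁ - 1.
second-relation : (A₁ A₂ B : ℤ) →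
  h~ A₁ · h~ B · h~ (A₂ - + 1) ⊕ h~ (A₁ - + 1) · h~ B · h~ A₂
    ⊖ h~ (A₁ - + 1) · h~ (+ 1) · h~ B · h~ (A₂ - + 1)
  ≐ h~ B · h~ ((A₁ + A₂) - + 1)
second-relation A₁ A₂ B = same-pairings pairings
  where
  T₁ T₂ T₃ : CH₂~
  T₁ = h~ A₁ · h~ B · h~ (A₂ - + 1)
  T₂ = h~ (A₁ - + 1) · h~ B · h~ A₂
  T₃ = h~ (A₁ - + 1) · h~ (+ 1) · h~ B · h~ (A₂ - + 1)
  cancel : ∀ p q r → p + q - (p + r) ≡ q - r
  cancel = solve-∀
  pairings : ∀ Φ → ⟪ T₁ ⊕ T₂ ⊖ T₃ ∣ Φ ⟫ ≡ ⟪ h~ B · h~ ((A₁ + A₂) - + 1) ∣ Φ ⟫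
  pairings Φ = begin
    ⟪ T₁ ⊕ T₂ ⊖ T₃ ∣ Φ ⟫
      ≡⟨ trans (⟪⊖⟫ (T₁ ⊕ T₂) T₃ Φ) (cong (_- ⟪ T₃ ∣ Φ ⟫) (⟪⊕⟫ T₁ T₂ Φ)) ⟩
    ⟪ T₁ ∣ Φ ⟫ + ⟪ T₂ ∣ Φ ⟫ - ⟪ T₃ ∣ Φ ⟫
      ≡⟨ cong₂ _-_ (cong₂ _+_ (⟪h~·h~·h~⟫ A₁ B (A₂ - + 1) Φ) (⟪h~·h~·h~⟫ (A₁ - + 1) B A₂ Φ))
                   (⟪h~·h~·h~·h~⟫ (A₁ - + 1) (+ 1) B (A₂ - + 1) Φ) ⟩
    h̃ᵀ A₁ F′ B + h̃ᵀ (A₁ - + 1) F B - h̃ᵀ (A₁ - + 1) (rᵀ B F′) (+ 1)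
      ≡⟨ cong₂ (λ u v → h̃ᵀ A₁ F′ B + u - v)
               (h̃ᵀ-comm (rᵀ-odd A₂ Φ) (A₁ - + 1) B)
               (h̃ᵀ-comm (rᵀ-odd B F′) (A₁ - + 1) (+ 1)) ⟩
    h̃ᵀ A₁ F′ B + h̃ᵀ B F (A₁ - + 1) - (rᵀ B F′ (A₁ - + 1 + + 1) + rᵀ B F′ (A₁ - + 1 - + 1))
      ≡⟨ cong₂ (λ u v → h̃ᵀ A₁ F′ B + h̃ᵀ B F (A₁ - + 1) - (h̃ᵀ u F′ B + v))
               (//-rightDividesˡ (+ 1) A₁) (h̃ᵀ-comm (rᵀ-odd (A₂ - + 1) Φ) (A₁ - + 1 - + 1) B) ⟩
    h̃ᵀ A₁ F′ B + h̃ᵀ B F (A₁ - + 1) - (h̃ᵀ A₁ F′ B + h̃ᵀ B F′ (A₁ - + 1 - + 1))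
      ≡⟨ cancel (h̃ᵀ A₁ F′ B) _ _ ⟩
    h̃ᵀ B F (A₁ - + 1) - h̃ᵀ B F′ (A₁ - + 1 - + 1)
      ≡⟨ h̃ᵀ-rᵀ-difference B Φ A₂ (A₁ - + 1) ⟩
    h̃ᵀ B Φ (A₁ - + 1 + A₂)
      ≡⟨ cong (h̃ᵀ B Φ) (solve (A₁ ∷ A₂ ∷ [])) ⟩
    h̃ᵀ B Φ ((A₁ + A₂) - + 1)
      ≡⟨ ⟪h~·h~⟫ B ((A₁ + A₂) - + 1) Φ ⟨
    ⟪ h~ B · h~ ((A₁ + A₂) - + 1) ∣ Φ ⟫ ∎
    where
    F F′ : ℤ → ℤ
    F  = rᵀ A₂ Φ
    F′ = rᵀ (A₂ - + 1) Φ

lemma2 : (A₁ A₂ B : ℤ) →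
    (h~ B · h~ A₁ · h~ A₂ ⊖ h~ B · h~ (A₁ - + 1) · h~ (A₂ - + 1) ≈ h~ B · h~ (A₁ + A₂))
    × (h~ A₁ · h~ B · h~ (A₂ - + 1) ⊕ h~ (A₁ - + 1) · h~ B · h~ A₂
         ⊖ h~ (A₁ - + 1) · h~ (+ 1) · h~ B · h~ (A₂ - + 1)
       ≈ h~ B · h~ ((A₁ + A₂) - + 1))
lemma2 A₁ A₂ B = ≐⇒≈ (first-relation A₁ A₂ B) , ≐⇒≈ (second-relation A₁ A₂ B)
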